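{- Let $S$ be a numerical semigroup with multiplicity $m$, embedding dimension $\nu$ and conductor $f+1=qm-\rho$ for some $q\in\mathbb N$, $0\le\rho\le m-1$. If $m-\nu=6$ and $\left(2+\frac1q\right)\nu\ge m$, then $S$ satisfies Wilf's Conjecture, i.e. $f+1\le\nu n$.
   Context: A numerical semigroup is a submonoid of $(\mathbb N,+)$ with finite complement. $f$ is its Frobenius number (largest integer not in $S$), $m$ its smallest nonzero element, $\nu$ its minimal number of generators, and $n=|\{s\in S: s<f\}|$. -}

module Defs where

open import Data.Nat using (ℕ; zero; suc; _+_; _*_; _≤_; _<_)
open import Data.List using (List; length; filter; upTo)
open import Data.List.Membership.Propositional using (_∈_)
open import Data.List.Relation.Unary.Unique.Propositional using (Unique)
open import Data.Product using (Σ; ∃; _×_; _,_)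
open import Relation.Nullary using (¬_)
open import Relation.Unary using (Pred; Decidable)
open import Relation.Binary.PropositionalEquality using (_≡_; _≢_)
open import Level using (0ℓ)
open import Function.Bundles using (_⇔_)

-- Membership is decidable (a set with finite complement always is,
-- classically; we require it explicitly so that counting makes sense).
record NumericalSemigroup : Set₁ where
  field
    _∈S    : Pred ℕ 0ℓ
    dec    : Decidable _∈S
    zero∈  : 0 ∈S
    closed : ∀ {a b} → a ∈S → b ∈S → (a + b) ∈S
    cofin  : Σ ℕ λ N → ∀ x → N ≤ x → x ∈S

module _ (S : NumericalSemigroup) where
  open NumericalSemigroup S

  IsFrobenius : ℕ → Set
  IsFrobenius f = ¬ (f ∈S) × (∀ x → f < x → x ∈S)

  IsMultiplicity : ℕ → Set
  IsMultiplicity m = m ∈S × 0 < m × (∀ x → 0 < x → x < m → ¬ (x ∈S))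

  IsMinGen : ℕ → Set
  IsMinGen x = x ∈S × 0 < x ×
    ¬ (Σ ℕ λ a → Σ ℕ λ b → a ∈S × 0 < a × b ∈S × 0 < b × a + b ≡ x)

  IsEmbDim : ℕ → Set
  IsEmbDim ν = Σ (List ℕ) λ gs → Unique gs × (∀ x → (x ∈ gs) ⇔ IsMinGen x) × length gs ≡ ν

  nBelow : ℕ → ℕ
  nBelow f = length (filter dec (upTo f))

-- Let c = f + 1 = q m − ρ. For an Apéry element v of S with respect to m, the numbers
-- v, v + m, v + 2m, … below c all lie in S; call their number depth v. Distinct Apéry
-- elements give disjoint strings, and the string of 0 has q elements, so
-- n ≥ q + Σ depth v over any set of nonzero Apéry elements. If a + b < c + m then
-- q ≤ 1 + depth a + depth b.
-- At least m − ν = 6 Apéry elements are not minimal generators, so they are sums s + t of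
-- smaller nonzero Apéry elements, and these six totals are distinct and below c + m. Two of
-- them provide distinct summands a, b with a + b < c + m; as only three sums can be formed
-- from a and b, some decomposition has a third summand y. Counting over {a, b, y} gives
-- n ≥ 2q and n ≥ q + 3, and when q ≥ 3 and ρ < q even n ≥ 2q + 1: either a fourth summand
-- exists, or the six totals are exactly the pairwise sums of a, b, y, all below c + m.
-- Finally (2 + 1/q) ν ≥ m = ν + 6 forces ν ≥ 6 or (ν, q) ∈ {(4, 2), (5, 2 … 5)}, where
-- these bounds give f + 1 ≤ ν n.
module Submission where

open import Defs
open import Data.Empty using (⊥-elim)
open import Data.List using (List; []; _∷_; length; filter; map; upTo; _++_; concatMap)
open import Data.List.Membership.Propositional using (_∈_; _∉_; find; lose)
open import Data.List.Membership.Propositional.Properties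
  using (∈-upTo⁺; ∈-upTo⁻; ∈-++⁺ˡ; ∈-++⁺ʳ; ∈-++⁻; ∈-filter⁺; ∈-filter⁻; ∈-map⁺; ∈-map⁻)
open import Data.List.Properties using (length-map; length-++; length-upTo; map-∘; filter-notAll)
open import Data.List.Relation.Binary.Subset.Propositional using (_⊆_)
open import Data.List.Relation.Unary.All as All using (All; []; _∷_; all?)
open import Data.List.Relation.Unary.All.Properties using (¬All⇒Any¬)
open import Data.List.Relation.Unary.Any as Any using (Any; here; there; any?)
open import Data.List.Relation.Unary.Unique.Propositional using (Unique; []; _∷_)
open import Data.List.Relation.Unary.Unique.Propositional.Properties using (upTo⁺; filter⁺; map⁺; map⁻; ++⁺)
open import Data.Nat
  using (ℕ; zero; suc; _+_; _*_; _∸_; _≤_; _<_; z≤n; s≤s; z<s; _≟_; _≤?_; _<?_; NonZero; >-nonZero)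
open import Data.List.Membership.DecPropositional _≟_ using (_∈?_)
open import Data.Nat.DivMod using (_%_; n%n≡0; [m+kn]%n≡m%n; m<n⇒m%n≡m)
open import Data.Nat.ListAction using (sum)
open import Data.Nat.Properties
open import Data.Nat.Solver using (module +-*-Solver)
open import Data.Product using (Σ; ∃; _×_; _,_; proj₁; proj₂)
open import Data.Sum using (inj₁; inj₂)
open import Function using (_∘_)
open import Function.Bundles using (Equivalence)
open import Level using (0ℓ)
open import Relation.Binary.Definitions using (tri<; tri≈; tri>)
open import Relation.Binary.PropositionalEquality
open import Relation.Nullary using (¬_; Dec; yes; no; ¬?; map′; contradiction)
open import Relation.Nullary.Decidable using (_×-dec_; decidable-stable; from-yes; from-no)
open import Relation.Unary using (Pred; Decidable)

open +-*-Solver using (solve; _:+_; _:*_; _:=_; con)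

mutual
  ⊆⇒length≤ : {xs ys : List ℕ} → Unique xs → xs ⊆ ys → length xs ≤ length ys
  ⊆⇒length≤ [] _ = z≤n
  ⊆⇒length≤ (x≢xs ∷ unique) sub =
    ⊆-missing⇒length< unique (sub ∘ there) (sub (here refl)) (λ x∈xs → All.lookup x≢xs x∈xs refl)

  ⊆-missing⇒length< : {xs ys : List ℕ} {y : ℕ} → Unique xs → xs ⊆ ys → y ∈ ys → y ∉ xs →
                      length xs < length ys
  ⊆-missing⇒length< {xs} {ys} {y} unique sub y∈ys y∉xs =
    ≤-<-trans (⊆⇒length≤ unique xs⊆ys-y)
              (filter-notAll (λ z → ¬? (z ≟ y)) ys (Any.map (λ { refl z≢z → z≢z refl }) y∈ys))
    where
    xs⊆ys-y : xs ⊆ filter (λ z → ¬? (z ≟ y)) ys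
    xs⊆ys-y z∈xs = ∈-filter⁺ _ (sub z∈xs) λ { refl → y∉xs z∈xs }

⊆∧length≥⇒⊇ : {xs ys : List ℕ} → Unique xs → xs ⊆ ys → length ys ≤ length xs → ys ⊆ xs
⊆∧length≥⇒⊇ {xs} unique sub ys≤xs {y} y∈ys with y ∈? xs
... | yes y∈xs = y∈xs
... | no y∉xs = contradiction ys≤xs (<⇒≱ (⊆-missing⇒length< unique sub y∈ys y∉xs))

preimages : {A B : Set} (g : A → B) (ys : List B) → (∀ {y} → y ∈ ys → ∃ λ x → g x ≡ y) →
            ∃ λ xs → map g xs ≡ ys
preimages g [] _ = [] , refl
preimages g (y ∷ ys) pre with x , refl ← pre (here refl) | xs , eq ← preimages g ys (pre ∘ there) =
  x ∷ xs , cong (g x ∷_) eq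

pairSums : List ℕ → List ℕ
pairSums [] = []
pairSums (x ∷ xs) = map (x +_) (x ∷ xs) ++ pairSums xs

∈-pairSums⁺ : ∀ {x y xs} → x ∈ xs → y ∈ xs → x + y ∈ pairSums xs
∈-pairSums⁺ {xs = z ∷ zs} (here refl) y∈ = ∈-++⁺ˡ (∈-map⁺ (z +_) y∈)
∈-pairSums⁺ {x} {xs = z ∷ zs} (there x∈) (here refl) =
  ∈-++⁺ˡ (subst (_∈ map (z +_) (z ∷ zs)) (+-comm z x) (∈-map⁺ (z +_) (there x∈)))
∈-pairSums⁺ {xs = z ∷ zs} (there x∈) (there y∈) = ∈-++⁺ʳ (map (z +_) (z ∷ zs)) (∈-pairSums⁺ x∈ y∈)

IsLeast : Pred ℕ 0ℓ → ℕ → Set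
IsLeast P k = P k × (∀ {j} → j < k → ¬ P j)

module _ {P : Pred ℕ 0ℓ} (P? : Decidable P) where

  private
    search : ∀ i → (∀ {j} → j < i → ¬ P j) → ∀ d → P (d + i) → ∃ (IsLeast P)
    search i below d p with P? i
    ... | yes pᵢ = i , pᵢ , below
    search i below zero p    | no ¬pᵢ = contradiction p ¬pᵢ
    search i below (suc d) p | no ¬pᵢ = search (suc i) below′ d (subst P (sym (+-suc d i)) p)
      where
      below′ : ∀ {j} → j < suc i → ¬ P j
      below′ j<1+i with m<1+n⇒m<n∨m≡n j<1+i
      ... | inj₁ j<i = below j<i
      ... | inj₂ refl = ¬pᵢ

  least : ∀ {n} → P n → ∃ (IsLeast P)
  least {n} p = search 0 (λ ()) n (subst P (sym (+-identityʳ n)) p)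

<⇒2+double≤double : ∀ {i j} → i < j → suc (suc (i + i)) ≤ j + j
<⇒2+double≤double {i} {j} i<j = subst (_≤ j + j) (cong suc (+-suc i i)) (+-mono-≤ i<j i<j)

doubles-adjacent⇒≡ : ∀ {a b} → a + a ≤ suc (b + b) → b + b ≤ suc (a + a) → a ≡ b
doubles-adjacent⇒≡ {a} {b} 2a≤2b+1 2b≤2a+1 with <-cmp a b
... | tri< a<b _ _ = contradiction 2b≤2a+1 (<⇒≱ (<⇒2+double≤double a<b))
... | tri≈ _ a≡b _ = a≡b
... | tri> _ _ b<a = contradiction 2a≤2b+1 (<⇒≱ (<⇒2+double≤double b<a))

module _ {c m : ℕ} (3m≤c+2 : m + (m + m) ≤ c + 2) where

  private
    c+m≤2+double : ∀ {a} → c ≤ a + m → c + m ≤ suc (suc (a + a))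
    c+m≤2+double {a} c≤a+m = +-cancelʳ-≤ (m + m) (c + m) _ (begin
      c + m + (m + m)       ≡⟨ +-assoc c m (m + m) ⟩
      c + (m + (m + m))     ≤⟨ +-monoʳ-≤ c 3m≤c+2 ⟩
      c + (c + 2)           ≡⟨ solve 1 (λ c → c :+ (c :+ con 2) := con 2 :+ (c :+ c)) refl c ⟩
      2 + (c + c)           ≤⟨ +-monoʳ-≤ 2 (+-mono-≤ c≤a+m c≤a+m) ⟩
      2 + (a + m + (a + m)) ≡⟨ solve 2 (λ a m → con 2 :+ (a :+ m :+ (a :+ m)) := con 2 :+ (a :+ a) :+ (m :+ m))
                                       refl a m ⟩
      2 + (a + a) + (m + m) ∎)
      where open ≤-Reasoning

  halves-of-window⇒≡ : ∀ {a b} → c ≤ a + m → c ≤ b + m → a + a < c + m → b + b < c + m → a ≡ b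
  halves-of-window⇒≡ c≤a+m c≤b+m 2a<c+m 2b<c+m = doubles-adjacent⇒≡
    (m<1+n⇒m≤n (<-≤-trans 2a<c+m (c+m≤2+double c≤b+m)))
    (m<1+n⇒m≤n (<-≤-trans 2b<c+m (c+m≤2+double c≤a+m)))

pairwise⇒≤3 : ∀ {q x y z} → q ≤ suc (x + y) → q ≤ suc (x + z) → q ≤ suc (y + z) →
              x + (y + z) ≤ q → q ≤ 3
pairwise⇒≤3 {q} {x} {y} {z} q≤xy q≤xz q≤yz T≤q = +-cancelʳ-≤ (q + q) q 3 (begin
  q + (q + q)                                ≤⟨ +-mono-≤ q≤xy (+-mono-≤ q≤xz q≤yz) ⟩
  suc (x + y) + (suc (x + z) + suc (y + z))  ≡⟨ solve 3 (λ x y z →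
                                                   con 1 :+ (x :+ y) :+ (con 1 :+ (x :+ z) :+ (con 1 :+ (y :+ z)))
                                                   := con 3 :+ ((x :+ (y :+ z)) :+ (x :+ (y :+ z)))) refl x y z ⟩
  3 + (x + (y + z) + (x + (y + z)))          ≤⟨ +-monoʳ-≤ 3 (+-mono-≤ T≤q T≤q) ⟩
  3 + (q + q)                                ∎)
  where open ≤-Reasoning

1+1+x≤3⇒x≤1 : ∀ {x y z} → 0 < y → 0 < z → x + (y + z) ≤ 3 → x ≤ 1
1+1+x≤3⇒x≤1 {x} {y} {z} 0<y 0<z sum≤3 = +-cancelʳ-≤ 2 x 1 (begin
  x + 2        ≤⟨ +-monoʳ-≤ x (+-mono-≤ 0<y 0<z) ⟩
  x + (y + z)  ≤⟨ sum≤3 ⟩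
  3            ∎)
  where open ≤-Reasoning

module Apéry (S : NumericalSemigroup) {m : ℕ} (mult : IsMultiplicity S m) where
  open NumericalSemigroup S

  private
    0<m : 0 < m
    0<m = proj₁ (proj₂ mult)

    instance
      m-nonZero : NonZero m
      m-nonZero = >-nonZero 0<m

  ∈S⇒m≤ : ∀ {x} → x ∈S → 0 < x → m ≤ x
  ∈S⇒m≤ {x} x∈S 0<x with m ≤? x
  ... | yes m≤x = m≤x
  ... | no m≰x = ⊥-elim (proj₂ (proj₂ mult) x 0<x (≰⇒> m≰x) x∈S)

  *m∈S : ∀ k → (k * m) ∈S
  *m∈S zero = zero∈
  *m∈S (suc k) = closed (proj₁ mult) (*m∈S k)

  +*m∈S : ∀ {x} k → x ∈S → (x + k * m) ∈S
  +*m∈S k x∈S = closed x∈S (*m∈S k)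

  Apéry : ℕ → Set
  Apéry w = w ∈S × (∀ y → y + m ≡ w → ¬ y ∈S)

  apéry-0 : Apéry 0
  apéry-0 = zero∈ , λ y y+m≡0 _ → <⇒≢ (≤-trans 0<m (m≤n+m m y)) (sym y+m≡0)

  apéry->m : ∀ {w} → Apéry w → 0 < w → m < w
  apéry->m (w∈S , w-m∉S) 0<w = ≤∧≢⇒< (∈S⇒m≤ w∈S 0<w) λ m≡w → w-m∉S 0 m≡w zero∈

  apéry-summand : ∀ {s t w} → Apéry w → s + t ≡ w → s ∈S → t ∈S → Apéry s
  apéry-summand {s} {t} (_ , w-m∉S) s+t≡w s∈S t∈S = s∈S , λ y y+m≡s y∈S →
    w-m∉S (y + t) (trans (solve 3 (λ y t m → y :+ t :+ m := y :+ m :+ t) refl y t m)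
                       (trans (cong (_+ t) y+m≡s) s+t≡w)) (closed y∈S t∈S)

  private
    apéry-unique-≤ : ∀ {a b i j} → Apéry a → b ∈S → i ≤ j → a + i * m ≡ b + j * m → a ≡ b
    apéry-unique-≤ {a} {b} {i} (_ , a-m∉S) b∈S i≤j eq with m≤n⇒∃[o]m+o≡n i≤j
    ... | zero , refl = +-cancelʳ-≡ (i * m) a b (trans eq (cong (λ k → b + k * m) (+-identityʳ i)))
    ... | suc d , refl = ⊥-elim (a-m∉S (b + d * m) b+dm+m≡a (+*m∈S d b∈S))
      where
      b+dm+m≡a : b + d * m + m ≡ a
      b+dm+m≡a = +-cancelʳ-≡ (i * m) _ a
        (trans (solve 4 (λ b d m i → b :+ d :* m :+ m :+ i :* m := b :+ (i :+ (con 1 :+ d)) :* m) refl b d m i)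
               (sym eq))

  apéry-unique : ∀ {a b i j} → Apéry a → Apéry b → a + i * m ≡ b + j * m → a ≡ b
  apéry-unique {i = i} {j} apa apb eq with ≤-total i j
  ... | inj₁ i≤j = apéry-unique-≤ apa (proj₁ apb) i≤j eq
  ... | inj₂ j≤i = sym (apéry-unique-≤ apb (proj₁ apa) j≤i (sym eq))

  apéry-exists : ∀ {r} → r < m → ∃ λ k → Apéry (r + k * m)
  apéry-exists {r} r<m with N , ≥N⇒∈S ← cofin
    with least {P = λ k → (r + k * m) ∈S} (λ k → dec (r + k * m)) {N}
               (≥N⇒∈S (r + N * m) (≤-trans (m≤m*n N m) (m≤n+m (N * m) r)))
  ... | k , r+km∈S , below = k , r+km∈S , no-predecessor k refl
    where
    no-predecessor : ∀ k′ → k′ ≡ k → ∀ y → y + m ≡ r + k′ * m → ¬ y ∈S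
    no-predecessor zero _ y y+m≡r _ = <⇒≢ (<-≤-trans r<m (m≤n+m m y)) (trans (sym (+-identityʳ r)) (sym y+m≡r))
    no-predecessor (suc j) refl y eq y∈S = below ≤-refl (subst _∈S y≡r+jm y∈S)
      where
      y≡r+jm : y ≡ r + j * m
      y≡r+jm = +-cancelʳ-≡ m y (r + j * m)
        (trans eq (solve 3 (λ r j m → r :+ (m :+ j :* m) := r :+ j :* m :+ m) refl r j m))

  apéry<f+1+m : ∀ {f} → IsFrobenius S f → ∀ {w} → Apéry w → w < f + 1 + m
  apéry<f+1+m {f} frob {w} (_ , w-m∉S) with f + 1 + m ≤? w
  ... | no f+1+m≰w = ≰⇒> f+1+m≰w
  ... | yes f+1+m≤w = ⊥-elim (w-m∉S (w ∸ m) (m∸n+n≡m m≤w) (proj₂ frob (w ∸ m) f<w-m))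
    where
    m≤w : m ≤ w
    m≤w = ≤-trans (m≤n+m m (f + 1)) f+1+m≤w
    f<w-m : f < w ∸ m
    f<w-m = subst (_≤ w ∸ m) (trans (m+n∸n≡m (f + 1) m) (+-comm f 1)) (∸-monoˡ-≤ m f+1+m≤w)

module Decompositions (S : NumericalSemigroup) {m : ℕ} (mult : IsMultiplicity S m) where
  open NumericalSemigroup S
  open Apéry S mult

  private
    0<m : 0 < m
    0<m = proj₁ (proj₂ mult)

    instance
      m-nonZero : NonZero m
      m-nonZero = >-nonZero 0<m

  Decomposable : ℕ → Set
  Decomposable w = Σ ℕ λ a → Σ ℕ λ b → a ∈S × 0 < a × b ∈S × 0 < b × a + b ≡ w

  decomposable? : ∀ w → Dec (Decomposable w)
  decomposable? w = map′ fromAny toAny (any? Q? (upTo w))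
    where
    Q : ℕ → Set
    Q a = a ∈S × 0 < a × (w ∸ a) ∈S × 0 < w ∸ a
    Q? : ∀ a → Dec (Q a)
    Q? a = dec a ×-dec 0 <? a ×-dec dec (w ∸ a) ×-dec 0 <? w ∸ a
    fromAny : Any Q (upTo w) → Decomposable w
    fromAny any with a , a∈ , a∈S , 0<a , b∈S , 0<b ← find any =
      a , w ∸ a , a∈S , 0<a , b∈S , 0<b , m+[n∸m]≡n (<⇒≤ (∈-upTo⁻ a∈))
    toAny : Decomposable w → Any Q (upTo w)
    toAny (a , b , a∈S , 0<a , b∈S , 0<b , refl) =
      lose (∈-upTo⁺ (m<m+n a 0<b)) (a∈S , 0<a , subst _∈S b≡ b∈S , subst (0 <_) b≡ 0<b)
      where
      b≡ : b ≡ a + b ∸ a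
      b≡ = sym (m+n∸m≡n a b)

  m-isMinGen : IsMinGen S m
  m-isMinGen = proj₁ mult , 0<m , λ (a , b , a∈S , 0<a , b∈S , 0<b , a+b≡m) →
    <⇒≢ (<-≤-trans (m<m+n m 0<m) (+-mono-≤ (∈S⇒m≤ a∈S 0<a) (∈S⇒m≤ b∈S 0<b))) (sym a+b≡m)

  record Decomposition : Set where
    field
      w s t : ℕ
      apéry : Apéry w
      s∈S   : s ∈S
      t∈S   : t ∈S
      0<s   : 0 < s
      0<t   : 0 < t
      s+t≡w : s + t ≡ w

  decomposition : ∀ {w} → Apéry w → Decomposable w → Decomposition
  decomposition {w} apw (a , b , a∈S , 0<a , b∈S , 0<b , a+b≡w) = record
    { w = w ; s = a ; t = b ; apéry = apw ; s∈S = a∈S ; t∈S = b∈S ; 0<s = 0<a ; 0<t = 0<b ; s+t≡w = a+b≡w }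

  module _ {ν : ℕ} (emb : IsEmbDim S ν) where
    private
      gens = proj₁ emb
      isMinGen⇔ = proj₁ (proj₂ (proj₂ emb))

      genResidues : List ℕ
      genResidues = map (_% m) gens

      otherResidues : List ℕ
      otherResidues = filter (λ r → ¬? (r ∈? genResidues)) (upTo m)

      m≤ν+|otherResidues| : m ≤ ν + length otherResidues
      m≤ν+|otherResidues| = subst₂ _≤_ (length-upTo m) |R++C|≡ (⊆⇒length≤ (upTo⁺ m) residues⊆)
        where
        residues⊆ : upTo m ⊆ genResidues ++ otherResidues
        residues⊆ {r} r∈ with r ∈? genResidues
        ... | yes r∈R = ∈-++⁺ˡ r∈R
        ... | no r∉R = ∈-++⁺ʳ genResidues (∈-filter⁺ (λ r → ¬? (r ∈? genResidues)) r∈ r∉R)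
        |R++C|≡ : length (genResidues ++ otherResidues) ≡ ν + length otherResidues
        |R++C|≡ = trans (length-++ genResidues)
          (cong (_+ length otherResidues) (trans (length-map (_% m) gens) (proj₂ (proj₂ (proj₂ emb)))))

      0∈genResidues : 0 ∈ genResidues
      0∈genResidues =
        subst (_∈ genResidues) (n%n≡0 m) (∈-map⁺ (_% m) (Equivalence.from (isMinGen⇔ m) m-isMinGen))

      decomposition-with-residue : ∀ {r} → r ∈ otherResidues → ∃ λ d → Decomposition.w d % m ≡ r
      decomposition-with-residue {r} r∈ with r∈upTo , r∉R ← ∈-filter⁻ (λ r → ¬? (r ∈? genResidues)) r∈
                                      with k , apw ← apéry-exists (∈-upTo⁻ r∈upTo) =
        decomposition apw (decidable-stable (decomposable? w) λ indec → w-notMinGen (proj₁ apw , 0<w , indec))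
        , w%m≡r
        where
        w = r + k * m
        w%m≡r : w % m ≡ r
        w%m≡r = trans ([m+kn]%n≡m%n r k m) (m<n⇒m%n≡m (∈-upTo⁻ r∈upTo))
        0<w : 0 < w
        0<w = ≤-trans (n≢0⇒n>0 λ { refl → r∉R 0∈genResidues }) (m≤m+n r (k * m))
        w-notMinGen : ¬ IsMinGen S w
        w-notMinGen gen = r∉R (subst (_∈ genResidues) w%m≡r (∈-map⁺ (_% m) (Equivalence.from (isMinGen⇔ w) gen)))

    decompositions : ∃ λ ds → Unique (map Decomposition.w ds) × m ≤ ν + length ds
    decompositions with ds , residues≡ ← preimages ((_% m) ∘ Decomposition.w) otherResidues decomposition-with-residue =
      ds , unique , subst (λ n → m ≤ ν + n) |C|≡|ds| m≤ν+|otherResidues|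
      where
      unique : Unique (map Decomposition.w ds)
      unique = map⁻ (subst Unique (trans (sym residues≡) (map-∘ ds))
                       (filter⁺ (λ r → ¬? (r ∈? genResidues)) (upTo⁺ m)))
      |C|≡|ds| : length otherResidues ≡ length ds
      |C|≡|ds| = trans (cong length (sym residues≡)) (length-map _ ds)

module Counting (S : NumericalSemigroup) {m : ℕ} (mult : IsMultiplicity S m)
                {f : ℕ} (frob : IsFrobenius S f) where
  open NumericalSemigroup S
  open Apéry S mult

  private
    instance
      m-nonZero : NonZero m
      m-nonZero = >-nonZero (proj₁ (proj₂ mult))

  c : ℕ
  c = f + 1

  -- depth v is the number of k with v + k m < c; opaque, so that unification treats it as rigid.
  opaque
    private
      depth-isLeast : ∀ v → ∃ (IsLeast (λ u → c ≤ v + u * m))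
      depth-isLeast v = least (λ u → c ≤? v + u * m) {c} (≤-trans (m≤m*n c m) (m≤n+m (c * m) v))

    depth : ℕ → ℕ
    depth v = proj₁ (depth-isLeast v)

    c≤+depth*m : ∀ v → c ≤ v + depth v * m
    c≤+depth*m v = proj₁ (proj₂ (depth-isLeast v))

    <depth⇒<c : ∀ {v k} → k < depth v → v + k * m < c
    <depth⇒<c {v} k<depth = ≰⇒> (proj₂ (proj₂ (depth-isLeast v)) k<depth)

  <c⇒0<depth : ∀ {v} → v < c → 0 < depth v
  <c⇒0<depth {v} v<c with depth v | c≤+depth*m v
  ... | zero  | c≤v+0 = contradiction (subst (c ≤_) (+-identityʳ v) c≤v+0) (<⇒≱ v<c)
  ... | suc _ | _     = z<s

  depth≤1⇒c≤+m : ∀ {v} → depth v ≤ 1 → c ≤ v + m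
  depth≤1⇒c≤+m {v} depth≤1 =
    ≤-trans (c≤+depth*m v) (+-monoʳ-≤ v (≤-trans (*-monoˡ-≤ m depth≤1) (≤-reflexive (*-identityˡ m))))

  layer : ℕ → List ℕ
  layer v = map (λ k → v + k * m) (upTo (depth v))

  layers : List ℕ → List ℕ
  layers = concatMap layer

  length-layers : ∀ V → length (layers V) ≡ sum (map depth V)
  length-layers [] = refl
  length-layers (v ∷ V) = trans (length-++ (layer v))
    (cong₂ _+_ (trans (length-map _ (upTo (depth v))) (length-upTo (depth v))) (length-layers V))

  ∈-layer⁻ : ∀ {v x} → x ∈ layer v → ∃ λ k → k < depth v × x ≡ v + k * m
  ∈-layer⁻ x∈ with k , k∈ , refl ← ∈-map⁻ _ x∈ = k , ∈-upTo⁻ k∈ , refl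

  ∈-layers⁻ : ∀ V {x} → x ∈ layers V → ∃ λ v → v ∈ V × x ∈ layer v
  ∈-layers⁻ (v ∷ V) x∈ with ∈-++⁻ (layer v) x∈
  ... | inj₁ x∈layer = v , here refl , x∈layer
  ... | inj₂ x∈layers with v′ , v′∈V , x∈layer ← ∈-layers⁻ V x∈layers = v′ , there v′∈V , x∈layer

  layer-unique : ∀ v → Unique (layer v)
  layer-unique v = map⁺ (λ {i} {j} eq → *-cancelʳ-≡ i j m (+-cancelˡ-≡ v _ _ eq)) (upTo⁺ (depth v))

  layers-unique : ∀ {V} → Unique V → All Apéry V → Unique (layers V)
  layers-unique [] [] = []
  layers-unique {v ∷ V} (v∉V ∷ unique) (apv ∷ apV) = ++⁺ (layer-unique v) (layers-unique unique apV) disjoint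
    where
    disjoint : ∀ {x} → ¬ (x ∈ layer v × x ∈ layers V)
    disjoint (x∈layer , x∈layers)
      with i , _ , refl ← ∈-layer⁻ x∈layer
         | v′ , v′∈V , x∈layer′ ← ∈-layers⁻ V x∈layers
      with j , _ , eq ← ∈-layer⁻ x∈layer′ =
      All.lookup v∉V v′∈V (apéry-unique {i = i} {j} apv (All.lookup apV v′∈V) eq)

  ∈S∧<c⇒<f : ∀ {x} → x ∈S → x < c → x < f
  ∈S∧<c⇒<f {x} x∈S x<c =
    ≤∧≢⇒< (m<1+n⇒m≤n (subst (x <_) (+-comm f 1) x<c)) λ { refl → proj₁ frob x∈S }

  layers⊆ : ∀ {V} → All Apéry V → layers V ⊆ filter dec (upTo f)
  layers⊆ {V} apV x∈ with v , v∈V , x∈layer ← ∈-layers⁻ V x∈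
                     with k , k<depth , refl ← ∈-layer⁻ x∈layer =
    ∈-filter⁺ dec (∈-upTo⁺ (∈S∧<c⇒<f x∈S (<depth⇒<c k<depth))) x∈S
    where
    x∈S = +*m∈S k (proj₁ (All.lookup apV v∈V))

  sum-depth≤nBelow : ∀ {V} → Unique V → All Apéry V → sum (map depth V) ≤ nBelow S f
  sum-depth≤nBelow {V} unique apV =
    subst (_≤ nBelow S f) (length-layers V) (⊆⇒length≤ (layers-unique unique apV) (layers⊆ apV))

  LowApéry : ℕ → Set
  LowApéry v = Apéry v × 0 < v × v < c

  module Ceiling {q ρ : ℕ} (c+ρ≡qm : c + ρ ≡ q * m) (ρ<m : ρ < m) where

    q≤depth-0 : q ≤ depth 0
    q≤depth-0 = ≮⇒≥ λ depth0<q → <⇒≱ (depth*m<c depth0<q) (c≤+depth*m 0)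
      where
      depth*m<c : depth 0 < q → depth 0 * m < c
      depth*m<c depth0<q = +-cancelʳ-< m _ c (begin-strict
        depth 0 * m + m   ≡⟨ +-comm (depth 0 * m) m ⟩
        suc (depth 0) * m ≤⟨ *-monoˡ-≤ m depth0<q ⟩
        q * m             ≡⟨ sym c+ρ≡qm ⟩
        c + ρ             <⟨ +-monoʳ-< c ρ<m ⟩
        c + m             ∎)
        where open ≤-Reasoning

    q+sum-depth≤nBelow : ∀ {V} → Unique V → All LowApéry V → q + sum (map depth V) ≤ nBelow S f
    q+sum-depth≤nBelow low-unique low = ≤-trans (+-monoˡ-≤ _ q≤depth-0)
      (sum-depth≤nBelow (All.map (λ (_ , 0<v , _) → <⇒≢ 0<v) low ∷ low-unique) (apéry-0 ∷ All.map proj₁ low))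

    q≤1+depth+depth : ∀ {a b} → a + b < c + m → q ≤ suc (depth a + depth b)
    q≤1+depth+depth {a} {b} a+b<c+m = m<1+n⇒m≤n (*-cancelʳ-< m q (2 + U) qm<[2+U]m)
      where
      U = depth a + depth b
      c+c<c+[1+U]m : c + c < c + (m + U * m)
      c+c<c+[1+U]m = begin-strict
        c + c                                 ≤⟨ +-mono-≤ (c≤+depth*m a) (c≤+depth*m b) ⟩
        (a + depth a * m) + (b + depth b * m) ≡⟨ solve 4 (λ a b x y → (a :+ x) :+ (b :+ y) := (a :+ b) :+ (x :+ y))
                                                         refl a b (depth a * m) (depth b * m) ⟩
        (a + b) + (depth a * m + depth b * m) ≡⟨ cong (a + b +_) (sym (*-distribʳ-+ m (depth a) (depth b))) ⟩
        (a + b) + U * m                       <⟨ +-monoˡ-< (U * m) a+b<c+m ⟩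
        (c + m) + U * m                       ≡⟨ +-assoc c m (U * m) ⟩
        c + (m + U * m)                       ∎
        where open ≤-Reasoning
      qm<[2+U]m : q * m < (2 + U) * m
      qm<[2+U]m = begin-strict
        q * m         ≡⟨ sym c+ρ≡qm ⟩
        c + ρ         <⟨ +-mono-<-≤ (+-cancelˡ-< c c _ c+c<c+[1+U]m) (<⇒≤ ρ<m) ⟩
        m + U * m + m ≡⟨ solve 2 (λ U m → m :+ U :* m :+ m := (con 2 :+ U) :* m) refl U m ⟩
        (2 + U) * m   ∎
        where open ≤-Reasoning

module Summands (S : NumericalSemigroup) {m : ℕ} (mult : IsMultiplicity S m)
                {f : ℕ} (frob : IsFrobenius S f) where
  open Apéry S mult
  open Decompositions S mult
  open Counting S mult frob
  open Decomposition

  swap : Decomposition → Decomposition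
  swap d = record d { s = t d ; t = s d ; s∈S = t∈S d ; t∈S = s∈S d ; 0<s = 0<t d ; 0<t = 0<s d
                    ; s+t≡w = trans (+-comm (t d) (s d)) (s+t≡w d) }

  w<c+m : ∀ d → w d < c + m
  w<c+m d = apéry<f+1+m frob (apéry d)

  s-apéry : ∀ d → Apéry (s d)
  s-apéry d = apéry-summand (apéry d) (s+t≡w d) (s∈S d) (t∈S d)

  s-low : ∀ d → LowApéry (s d)
  s-low d = s-apéry d , 0<s d , +-cancelʳ-< m (s d) c (begin-strict
    s d + m   <⟨ +-monoʳ-< (s d) (apéry->m (s-apéry (swap d)) (0<t d)) ⟩
    s d + t d ≡⟨ s+t≡w d ⟩
    w d       <⟨ w<c+m d ⟩
    c + m     ∎)
    where open ≤-Reasoning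

  t-low : ∀ d → LowApéry (t d)
  t-low d = s-low (swap d)

  record Pair : Set where
    field
      a b     : ℕ
      a≢b     : a ≢ b
      a-low   : LowApéry a
      b-low   : LowApéry b
      a+b<c+m : a + b < c + m

  summand-pair : ∀ d → s d ≢ t d → Pair
  summand-pair d s≢t = record { a = s d ; b = t d ; a≢b = s≢t ; a-low = s-low d ; b-low = t-low d
                              ; a+b<c+m = subst (_< c + m) (sym (s+t≡w d)) (w<c+m d) }

  distinct-pair : ∀ d₁ d₂ → w d₁ ≢ w d₂ → Pair
  distinct-pair d₁ d₂ w₁≢w₂ with s d₁ ≟ t d₁ | s d₂ ≟ t d₂
  ... | no s≢t | _ = summand-pair d₁ s≢t
  ... | yes _ | no s≢t = summand-pair d₂ s≢t
  ... | yes s≡t₁ | yes s≡t₂ = record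
    { a = s d₁ ; b = s d₂ ; a≢b = s₁≢s₂ ; a-low = s-low d₁ ; b-low = s-low d₂ ; a+b<c+m = s₁+s₂<c+m }
    where
    double : ∀ d → s d ≡ t d → s d + s d ≡ w d
    double d s≡t = trans (cong (s d +_) s≡t) (s+t≡w d)
    s₁≢s₂ : s d₁ ≢ s d₂
    s₁≢s₂ s₁≡s₂ = w₁≢w₂ (begin
      w d₁          ≡⟨ sym (double d₁ s≡t₁) ⟩
      s d₁ + s d₁   ≡⟨ cong (λ x → x + x) s₁≡s₂ ⟩
      s d₂ + s d₂   ≡⟨ double d₂ s≡t₂ ⟩
      w d₂          ∎)
      where open ≡-Reasoning
    s₁+s₂<c+m : s d₁ + s d₂ < c + m
    s₁+s₂<c+m with ≤-total (s d₁) (s d₂)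
    ... | inj₁ s₁≤s₂ =
      ≤-<-trans (subst (s d₁ + s d₂ ≤_) (double d₂ s≡t₂) (+-monoˡ-≤ (s d₂) s₁≤s₂)) (w<c+m d₂)
    ... | inj₂ s₂≤s₁ =
      ≤-<-trans (subst (s d₁ + s d₂ ≤_) (double d₁ s≡t₁) (+-monoʳ-≤ (s d₁) s₂≤s₁)) (w<c+m d₁)

  first-pair : ∀ ds → Unique (map w ds) → 2 ≤ length ds → Pair
  first-pair (d₁ ∷ d₂ ∷ _) ((w₁≢w₂ ∷ _) ∷ _) _ = distinct-pair d₁ d₂ w₁≢w₂
  first-pair (_ ∷ []) _ (s≤s ())

  SummandsIn : List ℕ → Decomposition → Set
  SummandsIn V d = s d ∈ V × t d ∈ V

  summandsIn? : ∀ V d → Dec (SummandsIn V d)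
  summandsIn? V d = s d ∈? V ×-dec t d ∈? V

  new-summand : ∀ {V} ds → ¬ All (SummandsIn V) ds → ∃ λ y → y ∉ V × LowApéry y
  new-summand {V} ds ¬all with d , _ , ¬inV ← find (¬All⇒Any¬ (summandsIn? V) ds ¬all)
                           with s d ∈? V
  ... | no s∉V = s d , s∉V , s-low d
  ... | yes s∈V = t d , (λ t∈V → ¬inV (s∈V , t∈V)) , t-low d

  totals⊆pairSums : ∀ {V} ds → All (SummandsIn V) ds → map w ds ⊆ pairSums V
  totals⊆pairSums ds inV x∈ with d , d∈ds , refl ← ∈-map⁻ w x∈ with s∈V , t∈V ← All.lookup inV d∈ds =
    subst (_∈ _) (s+t≡w d) (∈-pairSums⁺ s∈V t∈V)

module Bounds (S : NumericalSemigroup) {m : ℕ} (mult : IsMultiplicity S m) {f : ℕ} (frob : IsFrobenius S f)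
              {q ρ : ℕ} (c+ρ≡qm : f + 1 + ρ ≡ q * m) (ρ<m : ρ < m)
              (ds : List (Decompositions.Decomposition S mult))
              (unique : Unique (map (Decompositions.Decomposition.w {S = S} {mult = mult}) ds))
              (6≤|ds| : 6 ≤ length ds) where
  open Apéry S mult
  open Decompositions S mult
  open Counting S mult frob
  open Ceiling {q} c+ρ≡qm ρ<m
  open Summands S mult frob
  open Decomposition

  open Pair (first-pair ds unique (≤-trans (from-yes (2 ≤? 6)) 6≤|ds|))

  private
    0<depth : ∀ {v} → LowApéry v → 0 < depth v
    0<depth (_ , _ , v<c) = <c⇒0<depth v<c

    6≤|totals| : 6 ≤ length (map w ds)
    6≤|totals| = subst (6 ≤_) (sym (length-map w ds)) 6≤|ds|

    short-pairSums⇒new-summand : ∀ V → length (pairSums V) < 6 → ∃ λ y → y ∉ V × LowApéry y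
    short-pairSums⇒new-summand V |sums|<6 = new-summand ds λ inV →
      <⇒≱ |sums|<6 (≤-trans 6≤|totals| (⊆⇒length≤ unique (totals⊆pairSums ds inV)))

    all-summands⇒sums<c+m : ∀ V → length (pairSums V) ≤ 6 → All (SummandsIn V) ds →
                            ∀ {x x′} → x ∈ V → x′ ∈ V → x + x′ < c + m
    all-summands⇒sums<c+m V |sums|≤6 inV x∈ x′∈ =
      let d , _ , x+x′≡w = ∈-map⁻ w (pairSums⊆totals (∈-pairSums⁺ x∈ x′∈))
      in subst (_< c + m) (sym x+x′≡w) (w<c+m d)
      where
      pairSums⊆totals : pairSums V ⊆ map w ds
      pairSums⊆totals = ⊆∧length≥⇒⊇ unique (totals⊆pairSums ds inV) (≤-trans |sums|≤6 6≤|totals|)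

    q≡3⇒3m≤c+2 : q ≡ 3 → ρ < q → m + (m + m) ≤ c + 2
    q≡3⇒3m≤c+2 refl ρ<3 = begin
      m + (m + m)  ≡⟨ cong (λ x → m + (m + x)) (sym (+-identityʳ m)) ⟩
      3 * m        ≡⟨ sym c+ρ≡qm ⟩
      c + ρ        ≤⟨ +-monoʳ-≤ c (m<1+n⇒m≤n ρ<3) ⟩
      c + 2        ∎
      where open ≤-Reasoning

  2≤q : 2 ≤ q
  2≤q = *-cancelʳ-< m 1 q (begin-strict
    1 * m   ≡⟨ *-identityˡ m ⟩
    m       <⟨ +-cancelʳ-< m m c (begin-strict
                 m + m   <⟨ +-mono-< (apéry->m (proj₁ a-low) (proj₁ (proj₂ a-low)))
                                     (apéry->m (proj₁ b-low) (proj₁ (proj₂ b-low))) ⟩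
                 a + b   <⟨ a+b<c+m ⟩
                 c + m   ∎) ⟩
    c       ≤⟨ m≤m+n c ρ ⟩
    c + ρ   ≡⟨ c+ρ≡qm ⟩
    q * m   ∎)
    where open ≤-Reasoning

  module Triple {y : ℕ} (y∉ab : y ∉ a ∷ b ∷ []) (y-low : LowApéry y) where

    private
      a≢y : a ≢ y
      a≢y a≡y = y∉ab (here (sym a≡y))
      b≢y : b ≢ y
      b≢y b≡y = y∉ab (there (here (sym b≡y)))

      T : ℕ
      T = depth a + (depth b + depth y)

      count-aby : q + T ≤ nBelow S f
      count-aby = subst (λ x → q + (depth a + (depth b + x)) ≤ nBelow S f) (+-identityʳ (depth y))
        (q+sum-depth≤nBelow ((a≢b ∷ a≢y ∷ []) ∷ (b≢y ∷ []) ∷ [] ∷ []) (a-low ∷ b-low ∷ y-low ∷ []))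

      q≤T : q ≤ T
      q≤T = begin
        q                               ≤⟨ q≤1+depth+depth a+b<c+m ⟩
        suc (depth a + depth b)         ≡⟨ +-comm 1 (depth a + depth b) ⟩
        depth a + depth b + 1           ≤⟨ +-monoʳ-≤ (depth a + depth b) (0<depth y-low) ⟩
        depth a + depth b + depth y     ≡⟨ +-assoc (depth a) (depth b) (depth y) ⟩
        T                               ∎
        where open ≤-Reasoning

    2q≤n : q + q ≤ nBelow S f
    2q≤n = ≤-trans (+-monoʳ-≤ q q≤T) count-aby

    q+3≤n : q + 3 ≤ nBelow S f
    q+3≤n = ≤-trans (+-monoʳ-≤ q (+-mono-≤ (0<depth a-low) (+-mono-≤ (0<depth b-low) (0<depth y-low)))) count-aby

    module _ (3≤q : 3 ≤ q) (ρ<q : ρ < q) where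

      private
        V : List ℕ
        V = a ∷ b ∷ y ∷ []

        fourth-summand⇒2q+1≤n : ∀ {z} → z ∉ V → LowApéry z → suc (q + q) ≤ nBelow S f
        fourth-summand⇒2q+1≤n {z} z∉V z-low =
          ≤-trans (subst (_≤ q + T′) (+-suc q q) (+-monoʳ-≤ q 1+q≤T′)) count-abyz
          where
          T′ = depth a + (depth b + (depth y + (depth z + 0)))
          count-abyz : q + T′ ≤ nBelow S f
          count-abyz = q+sum-depth≤nBelow
            ((a≢b ∷ a≢y ∷ (λ a≡z → z∉V (here (sym a≡z))) ∷ [])
             ∷ (b≢y ∷ (λ b≡z → z∉V (there (here (sym b≡z)))) ∷ [])
             ∷ ((λ y≡z → z∉V (there (there (here (sym y≡z))))) ∷ []) ∷ [] ∷ [])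
            (a-low ∷ b-low ∷ y-low ∷ z-low ∷ [])
          1+q≤T′ : suc q ≤ T′
          1+q≤T′ = begin
            suc q                                   ≤⟨ s≤s (q≤1+depth+depth a+b<c+m) ⟩
            2 + (depth a + depth b)                 ≤⟨ +-monoˡ-≤ _ (+-mono-≤ (0<depth y-low) (0<depth z-low)) ⟩
            depth y + depth z + (depth a + depth b) ≡⟨ solve 4 (λ a b y z →
                                                         y :+ z :+ (a :+ b) := a :+ (b :+ (y :+ (z :+ con 0))))
                                                         refl (depth a) (depth b) (depth y) (depth z) ⟩
            T′                                      ∎
            where open ≤-Reasoning

        -- If T ≤ q, the three pairwise depth bounds force q = 3 and depth a = depth b = 1,
        -- which squeezes a + a and b + b into {c + m − 2, c + m − 1}, so a = b.
        all-summands⇒1+q≤T : All (SummandsIn V) ds → suc q ≤ T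
        all-summands⇒1+q≤T inV with suc q ≤? T
        ... | yes 1+q≤T = 1+q≤T
        ... | no 1+q≰T = contradiction
                (halves-of-window⇒≡ (q≡3⇒3m≤c+2 q≡3 ρ<q) (depth≤1⇒c≤+m a-depth≤1) (depth≤1⇒c≤+m b-depth≤1)
                                    (sum<c+m a∈V a∈V) (sum<c+m b∈V b∈V))
                a≢b
          where
          a∈V : a ∈ V
          a∈V = here refl
          b∈V : b ∈ V
          b∈V = there (here refl)
          y∈V : y ∈ V
          y∈V = there (there (here refl))
          sum<c+m : ∀ {x x′} → x ∈ V → x′ ∈ V → x + x′ < c + m
          sum<c+m = all-summands⇒sums<c+m V ≤-refl inV
          pair-bound : ∀ {x x′} → x ∈ V → x′ ∈ V → q ≤ suc (depth x + depth x′)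
          pair-bound {x} {x′} x∈ x′∈ = q≤1+depth+depth {x} {x′} (sum<c+m x∈ x′∈)
          T≤q : T ≤ q
          T≤q = m<1+n⇒m≤n (≰⇒> 1+q≰T)
          q≡3 : q ≡ 3
          q≡3 = ≤-antisym (pairwise⇒≤3 {x = depth a} {depth b} {depth y}
                             (pair-bound a∈V b∈V) (pair-bound a∈V y∈V) (pair-bound b∈V y∈V) T≤q) 3≤q
          T≤3 : T ≤ 3
          T≤3 = subst (T ≤_) q≡3 T≤q
          a-depth≤1 : depth a ≤ 1
          a-depth≤1 = 1+1+x≤3⇒x≤1 (0<depth b-low) (0<depth y-low) T≤3
          b-depth≤1 : depth b ≤ 1
          b-depth≤1 = 1+1+x≤3⇒x≤1 (0<depth a-low) (0<depth y-low)
            (subst (_≤ 3) (solve 3 (λ a b y → a :+ (b :+ y) := b :+ (a :+ y)) refl (depth a) (depth b) (depth y)) T≤3)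

      2q+1≤n : suc (q + q) ≤ nBelow S f
      2q+1≤n with all? (summandsIn? V) ds
      ... | yes inV = ≤-trans (subst (_≤ q + T) (+-suc q q) (+-monoʳ-≤ q (all-summands⇒1+q≤T inV))) count-aby
      ... | no ¬inV with z , z∉V , z-low ← new-summand ds ¬inV = fourth-summand⇒2q+1≤n z∉V z-low

  nBelow-bounds : q + q ≤ nBelow S f × q + 3 ≤ nBelow S f × (3 ≤ q → ρ < q → suc (q + q) ≤ nBelow S f)
  nBelow-bounds with y , y∉ab , y-low ← short-pairSums⇒new-summand (a ∷ b ∷ []) (from-yes (3 <? 6)) =
    2q≤n , q+3≤n , 2q+1≤n
    where open Triple y∉ab y-low

6∸ν*q≤ν : ∀ {q ν} → q * (ν + 6) ≤ (2 * q + 1) * ν → (6 ∸ ν) * q ≤ ν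
6∸ν*q≤ν {q} {ν} hyp = begin
  (6 ∸ ν) * q     ≡⟨ *-distribʳ-∸ q 6 ν ⟩
  6 * q ∸ ν * q   ≤⟨ m≤n+o⇒m∸n≤o (6 * q) (ν * q) 6q≤νq+ν ⟩
  ν               ∎
  where
  open ≤-Reasoning
  6q≤νq+ν : 6 * q ≤ ν * q + ν
  6q≤νq+ν = +-cancelˡ-≤ (q * ν) (6 * q) (ν * q + ν)
    (subst₂ _≤_ (solve 2 (λ q ν → q :* (ν :+ con 6) := q :* ν :+ con 6 :* q) refl q ν)
                (solve 2 (λ q ν → (con 2 :* q :+ con 1) :* ν := q :* ν :+ (ν :* q :+ ν)) refl q ν) hyp)

module WilfArithmetic {c ρ q n : ℕ} (2≤q : 2 ≤ q) (2q≤n : q + q ≤ n) (q+3≤n : q + 3 ≤ n)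
                      (2q+1≤n : 3 ≤ q → ρ < q → suc (q + q) ≤ n) where

  private
    c≤ : ∀ {N} → c + ρ ≡ N → c ≤ N
    c≤ {N} c+ρ≡N = subst (c ≤_) c+ρ≡N (m≤m+n c ρ)

  wilf-ν≥6 : ∀ {ν} → 6 ≤ ν → c + ρ ≡ q * (ν + 6) → c ≤ ν * n
  wilf-ν≥6 {ν} 6≤ν c+ρ≡qm = begin
    c            ≤⟨ c≤ c+ρ≡qm ⟩
    q * (ν + 6)  ≤⟨ *-monoʳ-≤ q (+-monoʳ-≤ ν 6≤ν) ⟩
    q * (ν + ν)  ≡⟨ solve 2 (λ q ν → q :* (ν :+ ν) := ν :* (q :+ q)) refl q ν ⟩
    ν * (q + q)  ≤⟨ *-monoʳ-≤ ν 2q≤n ⟩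
    ν * n        ∎
    where open ≤-Reasoning

  wilf-ν≡4 : q ≤ 2 → c + ρ ≡ q * 10 → c ≤ 4 * n
  wilf-ν≡4 q≤2 c+ρ≡qm with refl ← ≤-antisym q≤2 2≤q = begin
    c      ≤⟨ c≤ c+ρ≡qm ⟩
    20     ≤⟨ *-monoʳ-≤ 4 q+3≤n ⟩
    4 * n  ∎
    where open ≤-Reasoning

  wilf-ν≡5 : q ≤ 5 → c + ρ ≡ q * 11 → c ≤ 5 * n
  wilf-ν≡5 q≤5 c+ρ≡qm with ρ <? q
  ... | no ρ≮q = begin
    c            ≤⟨ +-cancelʳ-≤ q c (q * 10) (begin
                      c + q        ≤⟨ +-monoʳ-≤ c (≮⇒≥ ρ≮q) ⟩
                      c + ρ        ≡⟨ c+ρ≡qm ⟩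
                      q * 11       ≡⟨ solve 1 (λ q → q :* con 11 := q :* con 10 :+ q) refl q ⟩
                      q * 10 + q   ∎) ⟩
    q * 10       ≡⟨ solve 1 (λ q → q :* con 10 := con 5 :* (q :+ q)) refl q ⟩
    5 * (q + q)  ≤⟨ *-monoʳ-≤ 5 2q≤n ⟩
    5 * n        ∎
    where open ≤-Reasoning
  ... | yes ρ<q with q ≤? 2
  ...   | yes q≤2 with refl ← ≤-antisym q≤2 2≤q = begin
    c      ≤⟨ c≤ c+ρ≡qm ⟩
    22     ≤⟨ m≤m+n 22 3 ⟩
    25     ≤⟨ *-monoʳ-≤ 5 q+3≤n ⟩
    5 * n  ∎
    where open ≤-Reasoning
  ...   | no q≰2 = begin
    c                ≤⟨ c≤ c+ρ≡qm ⟩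
    q * 11           ≡⟨ solve 1 (λ q → q :* con 11 := q :* con 10 :+ q) refl q ⟩
    q * 10 + q       ≤⟨ +-monoʳ-≤ (q * 10) q≤5 ⟩
    q * 10 + 5       ≡⟨ solve 1 (λ q → q :* con 10 :+ con 5 := con 5 :* (con 1 :+ (q :+ q))) refl q ⟩
    5 * suc (q + q)  ≤⟨ *-monoʳ-≤ 5 (2q+1≤n (≰⇒> q≰2) ρ<q) ⟩
    5 * n            ∎
    where open ≤-Reasoning

  wilf-arithmetic : ∀ {m ν} → c + ρ ≡ q * m → m ≡ ν + 6 → q * m ≤ (2 * q + 1) * ν → c ≤ ν * n
  wilf-arithmetic {ν = ν@0} _ refl hyp =
    contradiction (≤-trans (*-monoʳ-≤ 6 2≤q) (6∸ν*q≤ν {q} {ν} hyp)) (from-no (12 ≤? 0))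
  wilf-arithmetic {ν = ν@1} _ refl hyp =
    contradiction (≤-trans (*-monoʳ-≤ 5 2≤q) (6∸ν*q≤ν {q} {ν} hyp)) (from-no (10 ≤? 1))
  wilf-arithmetic {ν = ν@2} _ refl hyp =
    contradiction (≤-trans (*-monoʳ-≤ 4 2≤q) (6∸ν*q≤ν {q} {ν} hyp)) (from-no (8 ≤? 2))
  wilf-arithmetic {ν = ν@3} _ refl hyp =
    contradiction (≤-trans (*-monoʳ-≤ 3 2≤q) (6∸ν*q≤ν {q} {ν} hyp)) (from-no (6 ≤? 3))
  wilf-arithmetic {ν = ν@4} c+ρ≡qm refl hyp = wilf-ν≡4 (*-cancelˡ-≤ 2 (6∸ν*q≤ν {q} {ν} hyp)) c+ρ≡qm
  wilf-arithmetic {ν = ν@5} c+ρ≡qm refl hyp =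
    wilf-ν≡5 (subst (_≤ 5) (*-identityˡ q) (6∸ν*q≤ν {q} {ν} hyp)) c+ρ≡qm
  wilf-arithmetic {ν = suc (suc (suc (suc (suc (suc ν)))))} c+ρ≡qm refl _ =
    wilf-ν≥6 (m≤m+n 6 ν) c+ρ≡qm

lemma5 : (S : NumericalSemigroup) (f m ν q ρ : ℕ) →
    IsFrobenius S f → IsMultiplicity S m → IsEmbDim S ν →
    f + 1 + ρ ≡ q * m → ρ < m →
    m ≡ ν + 6 →
    q * m ≤ (2 * q + 1) * ν →
    f + 1 ≤ ν * nBelow S f
lemma5 S f m ν q ρ frob mult emb c+ρ≡qm ρ<m m≡ν+6 hyp
  with ds , unique , m≤ν+|ds| ← Decompositions.decompositions S mult emb =
  let open Bounds S mult frob {q} c+ρ≡qm ρ<m ds unique 6≤|ds|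
      2q≤n , q+3≤n , 2q+1≤n = nBelow-bounds
  in WilfArithmetic.wilf-arithmetic 2≤q 2q≤n q+3≤n 2q+1≤n c+ρ≡qm m≡ν+6 hyp
  where
  6≤|ds| : 6 ≤ length ds
  6≤|ds| = +-cancelˡ-≤ ν 6 (length ds) (subst (_≤ ν + length ds) m≡ν+6 m≤ν+|ds|)
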